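{- Let $\mathsf{BA}$ and $\mathsf{SL}$ be the subvarieties of $V(\mathsf{BCA})$ axiomatised relative to $V(\mathsf{BCA})$ by $J_2x\approx x$ and by $J_2x\approx1$, respectively. Then $\mathsf{BA}$ and $\mathsf{SL}$ are independent subvarieties of $V(\mathsf{BCA})$, i.e. there is a binary term $\varphi(x,y)$ with $\mathsf{BA}\models\varphi(x,y)\approx x$ and $\mathsf{SL}\models\varphi(x,y)\approx y$.
   Context: $\mathbf{WK}^e$ is the algebra on $\{0,\tfrac12,1\}$ of type $\langle\wedge,\vee,\neg,J_2,0,1\rangle$ with $\neg0=1,\neg\tfrac12=\tfrac12,\neg1=0$; $\vee,\wedge$ Boolean on $\{0,1\}$ and outputting $\tfrac12$ whenever an argument is $\tfrac12$; $J_21=1$, $J_2\tfrac12=J_20=0$. $\mathsf{BCA}=ISP(\mathbf{WK}^e)$ and $V(\mathsf{BCA})$ is the variety it generates. -}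

module Defs where

open import Data.Fin using (Fin)
open import Data.Product using (Σ; ∃; _×_; _,_; proj₁)
open import Relation.Binary.PropositionalEquality using (_≡_)
open import Relation.Binary.Structures using (IsEquivalence)

record Alg : Set₁ where
  field
    Carrier : Set
    _≈_     : Carrier → Carrier → Set
    isEquiv : IsEquivalence _≈_
    _∧_ _∨_ : Carrier → Carrier → Carrier
    ¬_ J₂   : Carrier → Carrier
    𝟘 𝟙     : Carrier
    ∧-cong  : ∀ {a b c d} → a ≈ b → c ≈ d → (a ∧ c) ≈ (b ∧ d)
    ∨-cong  : ∀ {a b c d} → a ≈ b → c ≈ d → (a ∨ c) ≈ (b ∨ d)
    ¬-cong  : ∀ {a b} → a ≈ b → (¬ a) ≈ (¬ b)
    J₂-cong : ∀ {a b} → a ≈ b → J₂ a ≈ J₂ b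

data Three : Set where
  o h i : Three   -- o = 0, h = 1/2, i = 1

neg : Three → Three
neg o = i
neg h = h
neg i = o

meet : Three → Three → Three
meet h _ = h
meet _ h = h
meet o _ = o
meet i y = y

join : Three → Three → Three
join h _ = h
join _ h = h
join i _ = i
join o y = y

j2 : Three → Three
j2 i = i
j2 h = o
j2 o = o

record Subuniverse (I : Set) : Set₁ where
  field
    P      : (I → Three) → Set
    P-meet : ∀ f g → P f → P g → P (λ k → meet (f k) (g k))
    P-join : ∀ f g → P f → P g → P (λ k → join (f k) (g k))
    P-neg  : ∀ f → P f → P (λ k → neg (f k))
    P-j2   : ∀ f → P f → P (λ k → j2 (f k))
    P-0    : P (λ _ → o)
    P-1    : P (λ _ → i)

-- A ∈ V(BCA) = HSP(WK^e): A is a homomorphic image of a subalgebra of a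
-- power of WK^e (products over an index set I : Set).
record InV (A : Alg) : Set₁ where
  open Alg A
  field
    I    : Set
    S    : Subuniverse I
  open Subuniverse S
  B : Set
  B = Σ (I → Three) P
  field
    hom     : B → Carrier
    hom-resp : ∀ (b c : B) → (∀ k → proj₁ b k ≡ proj₁ c k) → hom b ≈ hom c
    hom-meet : ∀ f g (p : P f) (q : P g) →
               hom ((λ k → meet (f k) (g k)) , P-meet f g p q) ≈ (hom (f , p) ∧ hom (g , q))
    hom-join : ∀ f g (p : P f) (q : P g) →
               hom ((λ k → join (f k) (g k)) , P-join f g p q) ≈ (hom (f , p) ∨ hom (g , q))
    hom-neg  : ∀ f (p : P f) → hom ((λ k → neg (f k)) , P-neg f p) ≈ (¬ hom (f , p))
    hom-j2   : ∀ f (p : P f) → hom ((λ k → j2 (f k)) , P-j2 f p) ≈ J₂ (hom (f , p))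
    hom-0    : hom ((λ _ → o) , P-0) ≈ 𝟘
    hom-1    : hom ((λ _ → i) , P-1) ≈ 𝟙
    surj     : ∀ (a : Carrier) → ∃ λ (b : B) → hom b ≈ a

data Term (n : _) : Set where
  var         : Fin n → Term n
  _∧ₜ_ _∨ₜ_   : Term n → Term n → Term n
  ¬ₜ_ J₂ₜ_    : Term n → Term n
  0ₜ 1ₜ       : Term n

⟦_⟧ : ∀ {n} → Term n → (A : Alg) → (Fin n → Alg.Carrier A) → Alg.Carrier A
⟦ var x ⟧ A ρ = ρ x
⟦ s ∧ₜ t ⟧ A ρ = Alg._∧_ A (⟦ s ⟧ A ρ) (⟦ t ⟧ A ρ)
⟦ s ∨ₜ t ⟧ A ρ = Alg._∨_ A (⟦ s ⟧ A ρ) (⟦ t ⟧ A ρ)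
⟦ ¬ₜ t ⟧ A ρ = Alg.¬_ A (⟦ t ⟧ A ρ)
⟦ J₂ₜ t ⟧ A ρ = Alg.J₂ A (⟦ t ⟧ A ρ)
⟦ 0ₜ ⟧ A ρ = Alg.𝟘 A
⟦ 1ₜ ⟧ A ρ = Alg.𝟙 A

InBA : Alg → Set₁
InBA A = InV A × (∀ x → Alg._≈_ A (Alg.J₂ A x) x)

InSL : Alg → Set₁
InSL A = InV A × (∀ x → Alg._≈_ A (Alg.J₂ A x) (Alg.𝟙 A))

env2 : ∀ {X : Set} → X → X → Fin 2 → X
env2 x y Fin.zero = x
env2 x y (Fin.suc _) = y

-- Every identity of WKᵉ holds throughout V(BCA), since it holds coordinatewise in a power of WKᵉ,
-- hence in a subalgebra of it and in any homomorphic image. Take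
-- φ(x,y) = (J₂x ∧ ¬J₂0) ∨ (J₂0 ∧ y). In BA, J₂0 ≈ 0 and J₂ is the identity, and
-- (J₂x ∧ ¬0) ∨ (0 ∧ J₂y) ≈ J₂x holds in WKᵉ because J₂ only takes Boolean values. In SL,
-- J₂0 ≈ 1, and (J₂x ∧ ¬1) ∨ (1 ∧ y) ≈ y holds in WKᵉ for the same reason.
module Submission where

open import Defs
open import Data.Product using (Σ; _×_; _,_; proj₁; proj₂)
open import Data.Fin using (Fin; zero; suc)
open import Relation.Binary.Bundles using (Setoid)
open import Relation.Binary.PropositionalEquality
  using (_≡_; refl; sym; cong; cong₂; isEquivalence)
import Relation.Binary.Reasoning.Setoid as SetoidReasoning

WKᵉ : Alg
WKᵉ = record
  { Carrier = Three ; _≈_ = _≡_ ; isEquiv = isEquivalence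
  ; _∧_ = meet ; _∨_ = join ; ¬_ = neg ; J₂ = j2 ; 𝟘 = o ; 𝟙 = i
  ; ∧-cong = cong₂ meet ; ∨-cong = cong₂ join ; ¬-cong = cong neg ; J₂-cong = cong j2
  }

setoid : Alg → Setoid _ _
setoid A = record { isEquivalence = Alg.isEquiv A }

infix 4 _⊨_≈_
_⊨_≈_ : ∀ {n} → Alg → Term n → Term n → Set
A ⊨ s ≈ t = ∀ ρ → Alg._≈_ A (⟦ s ⟧ A ρ) (⟦ t ⟧ A ρ)

⟦⟧-cong : ∀ {n} (A : Alg) (s : Term n) {ρ ρ′ : Fin n → Alg.Carrier A} →
          (∀ j → Alg._≈_ A (ρ j) (ρ′ j)) → Alg._≈_ A (⟦ s ⟧ A ρ) (⟦ s ⟧ A ρ′)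
⟦⟧-cong A (var x)   e = e x
⟦⟧-cong A (s ∧ₜ t)  e = Alg.∧-cong A (⟦⟧-cong A s e) (⟦⟧-cong A t e)
⟦⟧-cong A (s ∨ₜ t)  e = Alg.∨-cong A (⟦⟧-cong A s e) (⟦⟧-cong A t e)
⟦⟧-cong A (¬ₜ t)    e = Alg.¬-cong A (⟦⟧-cong A t e)
⟦⟧-cong A (J₂ₜ t)   e = Alg.J₂-cong A (⟦⟧-cong A t e)
⟦⟧-cong A 0ₜ        e = Setoid.refl (setoid A)
⟦⟧-cong A 1ₜ        e = Setoid.refl (setoid A)

env2-η : ∀ {X : Set} (ρ : Fin 2 → X) j → env2 (ρ zero) (ρ (suc zero)) j ≡ ρ j
env2-η ρ zero          = refl
env2-η ρ (suc zero)    = refl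

WKᵉ⊨-by-env2 : (s t : Term 2) → (∀ a b → ⟦ s ⟧ WKᵉ (env2 a b) ≡ ⟦ t ⟧ WKᵉ (env2 a b)) →
               WKᵉ ⊨ s ≈ t
WKᵉ⊨-by-env2 s t holds ρ = begin
  ⟦ s ⟧ WKᵉ ρ                                 ≈⟨ ⟦⟧-cong WKᵉ s (λ j → sym (env2-η ρ j)) ⟩
  ⟦ s ⟧ WKᵉ (env2 (ρ zero) (ρ (suc zero)))    ≈⟨ holds (ρ zero) (ρ (suc zero)) ⟩
  ⟦ t ⟧ WKᵉ (env2 (ρ zero) (ρ (suc zero)))    ≈⟨ ⟦⟧-cong WKᵉ t (env2-η ρ) ⟩
  ⟦ t ⟧ WKᵉ ρ                                 ∎
  where open SetoidReasoning (setoid WKᵉ)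

module _ (A : Alg) (V : InV A) where
  open Alg A
  open InV V
  open Subuniverse S

  ⟦_⟧ᴮ : ∀ {n} → Term n → (Fin n → B) → B
  ⟦ var x  ⟧ᴮ β = β x
  ⟦ s ∧ₜ t ⟧ᴮ β = _ , P-meet _ _ (proj₂ (⟦ s ⟧ᴮ β)) (proj₂ (⟦ t ⟧ᴮ β))
  ⟦ s ∨ₜ t ⟧ᴮ β = _ , P-join _ _ (proj₂ (⟦ s ⟧ᴮ β)) (proj₂ (⟦ t ⟧ᴮ β))
  ⟦ ¬ₜ t   ⟧ᴮ β = _ , P-neg _ (proj₂ (⟦ t ⟧ᴮ β))
  ⟦ J₂ₜ t  ⟧ᴮ β = _ , P-j2 _ (proj₂ (⟦ t ⟧ᴮ β))
  ⟦ 0ₜ     ⟧ᴮ β = _ , P-0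
  ⟦ 1ₜ     ⟧ᴮ β = _ , P-1

  ⟦⟧ᴮ-coordinate : ∀ {n} (s : Term n) β k →
                   proj₁ (⟦ s ⟧ᴮ β) k ≡ ⟦ s ⟧ WKᵉ (λ j → proj₁ (β j) k)
  ⟦⟧ᴮ-coordinate (var x)  β k = refl
  ⟦⟧ᴮ-coordinate (s ∧ₜ t) β k = cong₂ meet (⟦⟧ᴮ-coordinate s β k) (⟦⟧ᴮ-coordinate t β k)
  ⟦⟧ᴮ-coordinate (s ∨ₜ t) β k = cong₂ join (⟦⟧ᴮ-coordinate s β k) (⟦⟧ᴮ-coordinate t β k)
  ⟦⟧ᴮ-coordinate (¬ₜ t)   β k = cong neg (⟦⟧ᴮ-coordinate t β k)
  ⟦⟧ᴮ-coordinate (J₂ₜ t)  β k = cong j2 (⟦⟧ᴮ-coordinate t β k)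
  ⟦⟧ᴮ-coordinate 0ₜ       β k = refl
  ⟦⟧ᴮ-coordinate 1ₜ       β k = refl

  open Setoid (setoid A) using () renaming (refl to ≈-refl; sym to ≈-sym; trans to ≈-trans)
  open SetoidReasoning (setoid A)

  hom-⟦⟧ : ∀ {n} (s : Term n) β → hom (⟦ s ⟧ᴮ β) ≈ ⟦ s ⟧ A (λ j → hom (β j))
  hom-⟦⟧ (var x)  β = ≈-refl
  hom-⟦⟧ (s ∧ₜ t) β = ≈-trans (hom-meet _ _ _ _) (∧-cong (hom-⟦⟧ s β) (hom-⟦⟧ t β))
  hom-⟦⟧ (s ∨ₜ t) β = ≈-trans (hom-join _ _ _ _) (∨-cong (hom-⟦⟧ s β) (hom-⟦⟧ t β))
  hom-⟦⟧ (¬ₜ t)   β = ≈-trans (hom-neg _ _) (¬-cong (hom-⟦⟧ t β))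
  hom-⟦⟧ (J₂ₜ t)  β = ≈-trans (hom-j2 _ _) (J₂-cong (hom-⟦⟧ t β))
  hom-⟦⟧ 0ₜ       β = hom-0
  hom-⟦⟧ 1ₜ       β = hom-1

  WKᵉ⊨⇒InV⊨ : ∀ {n} (s t : Term n) → WKᵉ ⊨ s ≈ t → A ⊨ s ≈ t
  WKᵉ⊨⇒InV⊨ s t holds ρ = begin
    ⟦ s ⟧ A ρ                     ≈⟨ ⟦⟧-cong A s (λ j → ≈-sym (preimage-hom j)) ⟩
    ⟦ s ⟧ A (λ j → hom (β j))     ≈⟨ hom-⟦⟧ s β ⟨
    hom (⟦ s ⟧ᴮ β)                ≈⟨ hom-resp (⟦ s ⟧ᴮ β) (⟦ t ⟧ᴮ β) agree ⟩
    hom (⟦ t ⟧ᴮ β)                ≈⟨ hom-⟦⟧ t β ⟩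
    ⟦ t ⟧ A (λ j → hom (β j))     ≈⟨ ⟦⟧-cong A t preimage-hom ⟩
    ⟦ t ⟧ A ρ                     ∎
    where
    β : ∀ j → B
    β j = proj₁ (surj (ρ j))
    preimage-hom : ∀ j → hom (β j) ≈ ρ j
    preimage-hom j = proj₂ (surj (ρ j))
    agree : ∀ k → proj₁ (⟦ s ⟧ᴮ β) k ≡ proj₁ (⟦ t ⟧ᴮ β) k
    agree k rewrite ⟦⟧ᴮ-coordinate s β k | ⟦⟧ᴮ-coordinate t β k =
      holds (λ j → proj₁ (β j) k)

x y : Term 2
x = var zero
y = var (suc zero)

φ : Term 2
φ = ((J₂ₜ x) ∧ₜ (¬ₜ (J₂ₜ 0ₜ))) ∨ₜ ((J₂ₜ 0ₜ) ∧ₜ y)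

φ-at-J₂0≈0 φ-at-J₂0≈1 : Term 2
φ-at-J₂0≈0 = ((J₂ₜ x) ∧ₜ (¬ₜ 0ₜ)) ∨ₜ (0ₜ ∧ₜ (J₂ₜ y))
φ-at-J₂0≈1 = ((J₂ₜ x) ∧ₜ (¬ₜ 1ₜ)) ∨ₜ (1ₜ ∧ₜ y)

WKᵉ⊨φ-at-J₂0≈0 : WKᵉ ⊨ φ-at-J₂0≈0 ≈ J₂ₜ x
WKᵉ⊨φ-at-J₂0≈0 = WKᵉ⊨-by-env2 φ-at-J₂0≈0 (J₂ₜ x) table
  where
  table : ∀ a b → ⟦ φ-at-J₂0≈0 ⟧ WKᵉ (env2 a b) ≡ j2 a
  table o o = refl
  table o h = refl
  table o i = refl
  table h o = refl
  table h h = refl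
  table h i = refl
  table i o = refl
  table i h = refl
  table i i = refl

WKᵉ⊨φ-at-J₂0≈1 : WKᵉ ⊨ φ-at-J₂0≈1 ≈ y
WKᵉ⊨φ-at-J₂0≈1 = WKᵉ⊨-by-env2 φ-at-J₂0≈1 y table
  where
  table : ∀ a b → ⟦ φ-at-J₂0≈1 ⟧ WKᵉ (env2 a b) ≡ b
  table o o = refl
  table o h = refl
  table o i = refl
  table h o = refl
  table h h = refl
  table h i = refl
  table i o = refl
  table i h = refl
  table i i = refl

module _ (A : Alg) where
  open Alg A
  open Setoid (setoid A) using () renaming (refl to ≈-refl; sym to ≈-sym)
  open SetoidReasoning (setoid A)

  BA⊨φ≈x : InBA A → ∀ a b → ⟦ φ ⟧ A (env2 a b) ≈ a
  BA⊨φ≈x (V , J₂-id) a b = begin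
    ⟦ φ ⟧ A (env2 a b)
      ≈⟨ ∨-cong (∧-cong ≈-refl (¬-cong (J₂-id 𝟘))) (∧-cong (J₂-id 𝟘) (≈-sym (J₂-id b))) ⟩
    ⟦ φ-at-J₂0≈0 ⟧ A (env2 a b)
      ≈⟨ WKᵉ⊨⇒InV⊨ A V φ-at-J₂0≈0 (J₂ₜ x) WKᵉ⊨φ-at-J₂0≈0 (env2 a b) ⟩
    J₂ a
      ≈⟨ J₂-id a ⟩
    a ∎

  SL⊨φ≈y : InSL A → ∀ a b → ⟦ φ ⟧ A (env2 a b) ≈ b
  SL⊨φ≈y (V , J₂≈1) a b = begin
    ⟦ φ ⟧ A (env2 a b)
      ≈⟨ ∨-cong (∧-cong ≈-refl (¬-cong (J₂≈1 𝟘))) (∧-cong (J₂≈1 𝟘) ≈-refl) ⟩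
    ⟦ φ-at-J₂0≈1 ⟧ A (env2 a b)
      ≈⟨ WKᵉ⊨⇒InV⊨ A V φ-at-J₂0≈1 y WKᵉ⊨φ-at-J₂0≈1 (env2 a b) ⟩
    b ∎

theorem4p10 : Σ (Term 2) λ φ →
    ((A : Alg) → InBA A → ∀ x y → Alg._≈_ A (⟦ φ ⟧ A (env2 x y)) x)
    × ((A : Alg) → InSL A → ∀ x y → Alg._≈_ A (⟦ φ ⟧ A (env2 x y)) y)
theorem4p10 = φ , BA⊨φ≈x , SL⊨φ≈y
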